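{- Let $\lambda$ be a nonempty partition, let $A=\mathcal{D}(\lambda)$ be the Downright game on $\lambda$, and let $\ell=d(\lambda)$. Then $$\mathbb{SG}(A)=\mathbb{SG}(A[1,1])=\mathbb{SG}(A[2,2])=\dots=\mathbb{SG}(A[\ell-1,\ell-1]).$$
   Context: For a partition $\mu=(\mu_1,\dots,\mu_s)$ and nonnegative integers $i,j$, the subpartition $\mu[i,j]$ is $(\mu_{i+1}-j,\mu_{i+2}-j,\dots)$ with nonpositive entries removed, if $i<s$ and $j<\mu_{i+1}$; otherwise $\mu[i,j]=()$ (empty). The Durfee length is $d(\lambda)=\max\{k:\lambda_k\ge k\}$. Downright $\mathcal{D}(\lambda)$ (for nonempty $\lambda$) is the impartial game under normal play whose positions are nonempty partitions; from $\mu=(\mu_1,\dots,\mu_s)$ one may move to $\mu[1,0]$ if $s>1$ and to $\mu[0,1]$ if $\mu_1>1$. For $A=\mathcal{D}(\lambda)$ and $\lambda[i,j]$ nonempty, $A[i,j]=\mathcal{D}(\lambda[i,j])$. $\mathbb{SG}$ denotes the Sprague--Grundy value, $\mathbb{SG}(A)=\operatorname{mex}\{\mathbb{SG}(B):A\to B\}$. -}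

module Defs where

open import Data.Nat using (ℕ; zero; suc; _+_; _∸_; _≤_; _<_; _≥_; _⊔_; _<ᵇ_; _≤ᵇ_)
open import Data.Bool using (Bool; true; false; if_then_else_)
open import Data.List using (List; []; _∷_; _++_; drop; map; filter; length; foldr)
open import Data.Bool.ListAction using (any)
open import Data.Nat.ListAction using (sum)
open import Data.List.Relation.Unary.All using (All)
open import Data.List.Relation.Unary.Linked using (Linked)
open import Data.Nat using (_≡ᵇ_)
open import Data.Nat.Properties using (_<?_)

record IsPartition (μ : List ℕ) : Set where
  field
    positive   : All (0 <_) μ
    decreasing : Linked _≥_ μ

-- μ[i,j] : (μ_{i+1} - j, μ_{i+2} - j, ...) with nonpositive entries removed,
-- provided i < s and j < μ_{i+1}; otherwise the empty partition.
sub : ℕ → ℕ → List ℕ → List ℕ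
sub i j μ with drop i μ
... | []     = []
... | x ∷ xs = if j <ᵇ x then filter (0 <?_) (map (_∸ j) (x ∷ xs)) else []

-- Durfee length d(λ) = max { k ≥ 1 : λ_k ≥ k }  (0 if there is no such k).
durfeeAux : ℕ → List ℕ → ℕ      -- k = index of the head entry (1-based)
durfeeAux k []       = 0
durfeeAux k (x ∷ xs) = (if k ≤ᵇ x then k else 0) ⊔ durfeeAux (suc k) xs

durfee : List ℕ → ℕ
durfee λ′ = durfeeAux 1 λ′

options : List ℕ → List (List ℕ)
options []       = []
options (x ∷ xs) =
  (if 1 <ᵇ length (x ∷ xs) then sub 1 0 (x ∷ xs) ∷ [] else [])
  ++ (if 1 <ᵇ x then sub 0 1 (x ∷ xs) ∷ [] else [])

mexAux : ℕ → ℕ → List ℕ → ℕ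
mexAux zero    n l = n
mexAux (suc f) n l = if any (n ≡ᵇ_) l then mexAux f (suc n) l else n

mex : List ℕ → ℕ
mex l = mexAux (suc (length l)) 0 l

-- Defined by recursion on a fuel parameter; every move strictly decreases
-- the sum of the parts, so fuel = sum μ suffices (sgF is then independent
-- of any larger fuel).
sgF : ℕ → List ℕ → ℕ
sgF zero    μ = 0
sgF (suc f) μ = mex (map (sgF f) (options μ))

SG : List ℕ → ℕ
SG μ = sgF (sum μ) μ

-- Since A[k+1,k+1] = A[k,k][1,1], and below the Durfee length the second part of
-- A[k,k] is at least 2, it suffices to show SG(μ[1,1]) = SG(μ) whenever μ₂ ≥ 2.
-- Put ν = μ[1,1]. Both options μ[1,0] and μ[0,1] of μ have ν as an option, so their
-- values differ from SG(ν). Conversely ν[1,0] = μ[1,0][1,1] and ν[0,1] = μ[0,1][1,1]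
-- whenever these moves exist, so by induction on the size every option of ν has the
-- value of an option of μ. A mex of a subset of a set that avoids the whole set is the
-- mex of the set, hence SG(ν) = SG(μ).
module Submission where

open import Defs
open import Data.Nat using (ℕ; _<_)
open import Data.List using (List; [])
open import Relation.Binary.PropositionalEquality using (_≡_; _≢_)

open import Data.Bool using (true; false; if_then_else_; T)
open import Data.Bool.ListAction using (any)
open import Data.List using (_∷_; map; filter; drop; length)
open import Data.List.Membership.Propositional using (_∈_; _∉_)
open import Data.List.Membership.Propositional.Properties using (∈-map⁺; ∈-map⁻; ∈-++⁺ʳ)
open import Data.List.Properties using (filter-accept; map-cong-local)
open import Data.List.Relation.Binary.Subset.Propositional using (_⊆_)
open import Data.List.Relation.Unary.All as All using (All; []; _∷_)
open import Data.List.Relation.Unary.All.Properties using (all-filter)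
open import Data.List.Relation.Unary.Any as Any using (here; there)
open import Data.List.Relation.Unary.Any.Properties using (any⁺; any⁻)
open import Data.List.Relation.Unary.Linked as Linked using (Linked; _∷_)
open import Data.List.Relation.Unary.Linked.Properties as LinkedP using (Linked⇒All)
open import Data.Nat using (zero; suc; _+_; _∸_; _≤_; _≥_; _⊔_; _≤ᵇ_; _<ᵇ_; _≡ᵇ_; z≤n; s≤s; z<s)
open import Data.Nat.Induction using (<-wellFounded)
open import Data.Nat.ListAction using (sum)
open import Data.Nat.Properties
open import Data.Product using (∃-syntax; _×_; _,_)
open import Data.Sum using (inj₁; inj₂)
open import Function using (_∘_)
open import Induction.WellFounded using (Acc; acc)
open import Relation.Binary.PropositionalEquality using (refl; sym; trans; cong; subst; module ≡-Reasoning)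
open import Relation.Binary.Definitions using (tri<; tri≈; tri>)
open import Relation.Nullary using (yes; no; does; contradiction)

count≥ : ℕ → List ℕ → ℕ
count≥ n []      = 0
count≥ n (x ∷ l) with n ≤? x
... | yes _ = suc (count≥ n l)
... | no _  = count≥ n l

count≥-≤-length : ∀ n l → count≥ n l ≤ length l
count≥-≤-length n []      = z≤n
count≥-≤-length n (x ∷ l) with n ≤? x
... | yes _ = s≤s (count≥-≤-length n l)
... | no _  = m≤n⇒m≤1+n (count≥-≤-length n l)

count≥-suc-≤ : ∀ n l → count≥ (suc n) l ≤ count≥ n l
count≥-suc-≤ n [] = z≤n
count≥-suc-≤ n (x ∷ l) with suc n ≤? x | n ≤? x
... | yes _   | yes _  = s≤s (count≥-suc-≤ n l)
... | yes n<x | no n≰x = contradiction (<⇒≤ n<x) n≰x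
... | no _    | yes _  = m≤n⇒m≤1+n (count≥-suc-≤ n l)
... | no _    | no _   = count≥-suc-≤ n l

count≥-suc-< : ∀ {n l} → n ∈ l → count≥ (suc n) l < count≥ n l
count≥-suc-< {n} {_ ∷ l} (here refl) with suc n ≤? n | n ≤? n
... | yes n<n | _      = contradiction n<n (n≮n n)
... | no _    | yes _  = s≤s (count≥-suc-≤ n l)
... | no _    | no n≰n = contradiction ≤-refl n≰n
count≥-suc-< {n} {x ∷ l} (there n∈l) with suc n ≤? x | n ≤? x
... | yes _   | yes _  = s≤s (count≥-suc-< n∈l)
... | yes n<x | no n≰x = contradiction (<⇒≤ n<x) n≰x
... | no _    | yes _  = m≤n⇒m≤1+n (count≥-suc-< n∈l)
... | no _    | no _   = count≥-suc-< n∈l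

any-≡ᵇ⇒∈ : ∀ n l → T (any (n ≡ᵇ_) l) → n ∈ l
any-≡ᵇ⇒∈ n l t = Any.map (≡ᵇ⇒≡ n _) (any⁻ (n ≡ᵇ_) l t)

∈⇒any-≡ᵇ : ∀ {n l} → n ∈ l → T (any (n ≡ᵇ_) l)
∈⇒any-≡ᵇ {n} n∈l = any⁺ (n ≡ᵇ_) (Any.map (≡⇒≡ᵇ n _) n∈l)

-- Each unsuccessful probe n ∈ l lowers count≥ n l, so the fuel never runs out.
mexAux-∉ : ∀ f n l → count≥ n l < f → mexAux f n l ∉ l
mexAux-∉ (suc f) n l c<f with any (n ≡ᵇ_) l | any-≡ᵇ⇒∈ n l | ∈⇒any-≡ᵇ {n} {l}
... | true  | n∈l | _    = mexAux-∉ f (suc n) l (≤-trans (count≥-suc-< (n∈l _)) (≤-pred c<f))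
... | false | _   | n∉l  = n∉l

mexAux-below : ∀ f n l → (∀ {k} → k < n → k ∈ l) → ∀ {k} → k < mexAux f n l → k ∈ l
mexAux-below zero    n l below = below
mexAux-below (suc f) n l below with any (n ≡ᵇ_) l | any-≡ᵇ⇒∈ n l
... | true  | n∈l = mexAux-below f (suc n) l below′
  where
  below′ : ∀ {k} → k < suc n → k ∈ l
  below′ {k} k<1+n with m≤n⇒m<n∨m≡n (≤-pred k<1+n)
  ... | inj₁ k<n  = below k<n
  ... | inj₂ refl = n∈l _
... | false | _   = below

mex-∉ : ∀ l → mex l ∉ l
mex-∉ l = mexAux-∉ (suc (length l)) 0 l (s≤s (count≥-≤-length 0 l))

mex-below : ∀ l {k} → k < mex l → k ∈ l
mex-below l = mexAux-below (suc (length l)) 0 l (λ ())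

mex-unique : ∀ l m → m ∉ l → (∀ {k} → k < m → k ∈ l) → mex l ≡ m
mex-unique l m m∉l below with <-cmp (mex l) m
... | tri< mex<m _ _ = contradiction (below mex<m) (mex-∉ l)
... | tri≈ _ eq _    = eq
... | tri> _ _ m<mex = contradiction (mex-below l m<mex) m∉l

mex-⊆⇒≡ : ∀ {s t} → s ⊆ t → mex s ∉ t → mex t ≡ mex s
mex-⊆⇒≡ {s} s⊆t mex∉t = mex-unique _ (mex s) mex∉t (s⊆t ∘ mex-below s)

-- dropColumns j μ is the paper's μ[0,j] (it agrees with sub 0 j μ when j < μ₁).
dropColumns : ℕ → List ℕ → List ℕ
dropColumns j l = filter (0 <?_) (map (_∸ j) l)

≥-trans : ∀ {i j k : ℕ} → i ≥ j → j ≥ k → i ≥ k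
≥-trans i≥j j≥k = ≤-trans j≥k i≥j

dropColumns-positive : ∀ j l → All (0 <_) (dropColumns j l)
dropColumns-positive j l = all-filter (0 <?_) (map (_∸ j) l)

dropColumns-isPartition : ∀ {j l} → Linked _≥_ l → IsPartition (dropColumns j l)
dropColumns-isPartition {j} {l} dec = record
  { positive   = dropColumns-positive j l
  ; decreasing = LinkedP.filter⁺ (0 <?_) ≥-trans
                   (LinkedP.map⁺ (Linked.map (∸-monoˡ-≤ j) dec))
  }

dropColumns-zero : ∀ {l} → All (0 <_) l → dropColumns 0 l ≡ l
dropColumns-zero []                 = refl
dropColumns-zero (s≤s z≤n ∷ pos) = cong (_ ∷_) (dropColumns-zero pos)

dropColumns-cons : ∀ j {x} xs → j < x → dropColumns j (x ∷ xs) ≡ (x ∸ j) ∷ dropColumns j xs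
dropColumns-cons j xs j<x = filter-accept (0 <?_) (m<n⇒0<n∸m j<x)

dropColumns-≢[] : ∀ {j x} xs → j < x → dropColumns j (x ∷ xs) ≢ []
dropColumns-≢[] xs j<x eq with trans (sym (dropColumns-cons _ xs j<x)) eq
... | ()

dropColumns-≡[] : ∀ {j l} → All (_≤ j) l → dropColumns j l ≡ []
dropColumns-≡[] []                       = refl
dropColumns-≡[] (_∷_ {x} x≤j small) rewrite m≤n⇒m∸n≡0 x≤j = dropColumns-≡[] small

filter-∷-cong : ∀ w {A B} → filter (0 <?_) A ≡ filter (0 <?_) B →
                filter (0 <?_) (w ∷ A) ≡ filter (0 <?_) (w ∷ B)
filter-∷-cong w eq with does (0 <? w)
... | true  = cong (w ∷_) eq
... | false = eq

dropColumns-dropColumns : ∀ i j l → dropColumns i (dropColumns j l) ≡ dropColumns (j + i) l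
dropColumns-dropColumns i j []      = refl
dropColumns-dropColumns i j (x ∷ l) rewrite sym (∸-+-assoc x j i) = shift (x ∸ j)
  where
  shift : ∀ v → dropColumns i (filter (0 <?_) (v ∷ map (_∸ j) l))
              ≡ filter (0 <?_) ((v ∸ i) ∷ map (_∸ (j + i)) l)
  shift zero    rewrite 0∸n≡0 i = dropColumns-dropColumns i j l
  shift (suc v) = filter-∷-cong (suc v ∸ i) (dropColumns-dropColumns i j l)

sum-filter-positive : ∀ l → sum (filter (0 <?_) l) ≡ sum l
sum-filter-positive []          = refl
sum-filter-positive (zero ∷ l)  = sum-filter-positive l
sum-filter-positive (suc x ∷ l) = cong (suc x +_) (sum-filter-positive l)

sum-map-∸ : ∀ j l → sum (map (_∸ j) l) ≤ sum l
sum-map-∸ j []      = z≤n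
sum-map-∸ j (x ∷ l) = +-mono-≤ (m∸n≤m x j) (sum-map-∸ j l)

-- On positive lists these are the moves μ → μ[1,0] and μ → μ[0,1].
data Move : List ℕ → List ℕ → Set where
  down  : ∀ {x xs} → xs ≢ [] → Move (x ∷ xs) xs
  right : ∀ {x xs} → 1 < x → Move (x ∷ xs) (dropColumns 1 (x ∷ xs))

options-sound : ∀ {μ o} → All (0 <_) μ → o ∈ options μ → Move μ o
options-sound {suc zero ∷ []}           _            ()
options-sound {suc zero ∷ suc _ ∷ _}    (_ ∷ pos)    (here refl) =
  subst (Move _) (sym (dropColumns-zero pos)) (down λ ())
options-sound {suc (suc _) ∷ []}        _            (here refl) = right (s≤s (s≤s z≤n))
options-sound {suc (suc _) ∷ suc _ ∷ _} (_ ∷ pos)    (here refl) =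
  subst (Move _) (sym (dropColumns-zero pos)) (down λ ())
options-sound {suc (suc _) ∷ suc _ ∷ _} _            (there (here refl)) = right (s≤s (s≤s z≤n))
options-sound {zero ∷ _}                (() ∷ _)     _
options-sound {suc _ ∷ zero ∷ _}        (_ ∷ () ∷ _) _

options-complete : ∀ {μ o} → All (0 <_) μ → Move μ o → o ∈ options μ
options-complete {_ ∷ []}          _            (down ne)        = contradiction refl ne
options-complete {_ ∷ suc _ ∷ _}   (_ ∷ pos)    (down _)         = here (sym (dropColumns-zero pos))
options-complete {_ ∷ zero ∷ _}    (_ ∷ () ∷ _) (down _)
options-complete {suc (suc _) ∷ _} _            (right _)        = ∈-++⁺ʳ _ (here refl)
options-complete {suc zero ∷ _}    _            (right (s≤s ()))

Move-positive : ∀ {μ o} → All (0 <_) μ → Move μ o → All (0 <_) o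
Move-positive (_ ∷ pos) (down _)  = pos
Move-positive {μ} _     (right _) = dropColumns-positive 1 μ

Move-sum-< : ∀ {μ o} → All (0 <_) μ → Move μ o → sum o < sum μ
Move-sum-< {suc x ∷ xs} _ (down _) = s≤s (m≤n+m (sum xs) x)
Move-sum-< {suc x ∷ xs} _ (right _) = begin-strict
  sum (dropColumns 1 (suc x ∷ xs)) ≡⟨ sum-filter-positive (x ∷ map (_∸ 1) xs) ⟩
  x + sum (map (_∸ 1) xs)           ≤⟨ +-monoʳ-≤ x (sum-map-∸ 1 xs) ⟩
  x + sum xs                        <⟨ n<1+n _ ⟩
  suc x + sum xs                    ∎
  where open ≤-Reasoning
Move-sum-< {zero ∷ _} (() ∷ _) _

sgF-[] : ∀ f → sgF f [] ≡ 0
sgF-[] zero    = refl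
sgF-[] (suc f) = refl

sgF-fuel : ∀ {μ} f g → All (0 <_) μ → sum μ ≤ f → sum μ ≤ g → sgF f μ ≡ sgF g μ
sgF-fuel {[]} f g _ _ _ = trans (sgF-[] f) (sym (sgF-[] g))
sgF-fuel {suc _ ∷ _} (suc f) (suc g) pos ≤f ≤g =
  cong mex (map-cong-local (All.tabulate λ o∈ →
    let m = options-sound pos o∈ in
    sgF-fuel f g (Move-positive pos m) (≤-pred (≤-trans (Move-sum-< pos m) ≤f))
                                       (≤-pred (≤-trans (Move-sum-< pos m) ≤g))))
sgF-fuel {suc _ ∷ _} zero    _       _ () _
sgF-fuel {suc _ ∷ _} (suc _) zero    _ _ ()
sgF-fuel {zero ∷ _}  _       _       (() ∷ _) _ _

followerSGs : List ℕ → List ℕ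
followerSGs μ = map SG (options μ)

SG-unfold : ∀ {μ} → All (0 <_) μ → SG μ ≡ mex (followerSGs μ)
SG-unfold {[]}         _   = refl
SG-unfold {suc x ∷ xs} pos = cong mex (map-cong-local (All.tabulate λ o∈ →
  let m = options-sound pos o∈ in
  sgF-fuel _ _ (Move-positive pos m) (≤-pred (Move-sum-< pos m)) ≤-refl))
SG-unfold {zero ∷ _}   (() ∷ _)

followerSGs⁺ : ∀ {μ o} → All (0 <_) μ → Move μ o → SG o ∈ followerSGs μ
followerSGs⁺ pos m = ∈-map⁺ SG (options-complete pos m)

followerSGs⁻ : ∀ {μ k} → All (0 <_) μ → k ∈ followerSGs μ → ∃[ o ] Move μ o × k ≡ SG o
followerSGs⁻ pos k∈ with ∈-map⁻ SG k∈
... | o , o∈ , eq = o , options-sound pos o∈ , eq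

SG-Move-≢ : ∀ {μ o} → All (0 <_) μ → Move μ o → SG o ≢ SG μ
SG-Move-≢ pos m eq = mex-∉ _ (subst (_∈ _) (trans eq (SG-unfold pos)) (followerSGs⁺ pos m))

SG-≡-of-simulation : ∀ {μ ν} → All (0 <_) μ → All (0 <_) ν →
  (∀ {o} → Move ν o → ∃[ o′ ] Move μ o′ × SG o ≡ SG o′) →
  (∀ {o} → Move μ o → Move o ν) →
  SG ν ≡ SG μ
SG-≡-of-simulation {μ} {ν} posμ posν simulate reach = begin
  SG ν                  ≡⟨ SG-unfold posν ⟩
  mex (followerSGs ν)   ≡⟨ sym (mex-⊆⇒≡ ν⊆μ mex∉μ) ⟩
  mex (followerSGs μ)   ≡⟨ sym (SG-unfold posμ) ⟩
  SG μ                  ∎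
  where
  open ≡-Reasoning
  ν⊆μ : followerSGs ν ⊆ followerSGs μ
  ν⊆μ k∈ with followerSGs⁻ posν k∈
  ... | o , m , refl with simulate m
  ... | o′ , m′ , eq = subst (_∈ _) (sym eq) (followerSGs⁺ posμ m′)
  mex∉μ : mex (followerSGs ν) ∉ followerSGs μ
  mex∉μ k∈ with followerSGs⁻ posμ k∈
  ... | o , m , eq = SG-Move-≢ (Move-positive posμ m) (reach m) (trans (SG-unfold posν) eq)

IsPartition-tail : ∀ {x xs} → IsPartition (x ∷ xs) → IsPartition xs
IsPartition-tail p = record
  { positive   = All.tail (IsPartition.positive p)
  ; decreasing = Linked.tail (IsPartition.decreasing p)
  }

-- dropColumns 1 xs is (x ∷ xs)[1,1]; for a partition it is nonempty iff the second part exceeds 1.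
SG-dropColumns-tail : ∀ {x xs} → IsPartition (x ∷ xs) → dropColumns 1 xs ≢ [] →
                      SG (dropColumns 1 xs) ≡ SG (x ∷ xs)
SG-dropColumns-tail p ne = go p ne (<-wellFounded _)
  where
  go : ∀ {x xs} → IsPartition (x ∷ xs) → dropColumns 1 xs ≢ [] → Acc _<_ (sum (x ∷ xs)) →
       SG (dropColumns 1 xs) ≡ SG (x ∷ xs)
  go {xs = []} _ ne _ = contradiction refl ne
  go {xs = suc zero ∷ _} p ne _ =
    contradiction (dropColumns-≡[] (Linked⇒All ≥-trans ≤-refl
                                      (Linked.tail (IsPartition.decreasing p)))) ne
  go {suc (suc x)} {μ₁@(suc (suc y)) ∷ r} p _ (acc rec) =
    SG-≡-of-simulation posμ (dropColumns-positive 1 (μ₁ ∷ r)) simulate reach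
    where
    μ ν : List ℕ
    μ = suc (suc x) ∷ μ₁ ∷ r
    ν = dropColumns 1 (μ₁ ∷ r)
    posμ : All (0 <_) μ
    posμ = IsPartition.positive p
    1<2+x : 1 < 2 + x
    1<2+x = s≤s (s≤s z≤n)
    simulate : ∀ {o} → Move ν o → ∃[ o′ ] Move μ o′ × SG o ≡ SG o′
    simulate (down ne′) =
      _ , down (λ ()) , go (IsPartition-tail p) ne′ (rec (Move-sum-< posμ (down λ ())))
    simulate (right (s≤s (s≤s z≤n))) =
      _ , right 1<2+x , go {suc x} (dropColumns-isPartition {1} (IsPartition.decreasing p)) (λ ())
                            (rec (Move-sum-< posμ (right 1<2+x)))
    reach : ∀ {o} → Move μ o → Move o ν
    reach (down _)  = right (s≤s (s≤s z≤n))
    reach (right _) = down (λ ())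
  go {xs = zero ∷ _} record { positive = _ ∷ () ∷ _ } _ _
  go {zero}       {suc (suc _) ∷ _} record { decreasing = () ∷ _ } _ _
  go {suc zero}   {suc (suc _) ∷ _} record { decreasing = s≤s () ∷ _ } _ _

if-≤ : ∀ b s → (if b then s else 0) ≤ s
if-≤ true  s = ≤-refl
if-≤ false s = z≤n

≤⊔⇒≤ʳ : ∀ {t c d} → t ≤ c ⊔ d → c < t → t ≤ d
≤⊔⇒≤ʳ {t} {c} {d} t≤c⊔d c<t with ⊔-sel c d
... | inj₁ c⊔d≡c = contradiction (subst (t ≤_) c⊔d≡c t≤c⊔d) (<⇒≱ c<t)
... | inj₂ c⊔d≡d = subst (t ≤_) c⊔d≡d t≤c⊔d

durfeeAux-≤-head : ∀ s {x xs} → Linked _≥_ (x ∷ xs) → durfeeAux s (x ∷ xs) ≤ x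
durfeeAux-≤-head s {x} {xs} dec = ⊔-lub head-term (rest xs dec)
  where
  head-term : (if s ≤ᵇ x then s else 0) ≤ x
  head-term with s ≤ᵇ x | ≤ᵇ⇒≤ s x
  ... | true  | s≤x = s≤x _
  ... | false | _   = z≤n
  rest : ∀ xs → Linked _≥_ (x ∷ xs) → durfeeAux (suc s) xs ≤ x
  rest []      _           = z≤n
  rest (_ ∷ _) (x≥y ∷ dec) = ≤-trans (durfeeAux-≤-head (suc s) dec) x≥y

-- durfeeAux s l is the largest s + p with s + p ≤ l_p (0-based p), or 0; a value
-- at least s + i is attained at some p ≥ i, and l_i ≥ l_p.
durfeeAux-drop : ∀ s i {l} → Linked _≥_ l → suc s + i ≤ durfeeAux (suc s) l →
                 ∃[ y ] ∃[ r ] drop i l ≡ y ∷ r × suc s + i ≤ y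
durfeeAux-drop s zero    {x ∷ xs} dec bound = x , xs , refl , ≤-trans bound (durfeeAux-≤-head _ dec)
durfeeAux-drop s (suc i) {x ∷ xs} dec bound
  with durfeeAux-drop (suc s) i (Linked.tail dec)
         (subst (_≤ durfeeAux (suc (suc s)) xs) (+-suc (suc s) i)
           (≤⊔⇒≤ʳ bound (≤-<-trans (if-≤ (suc s ≤ᵇ x) (suc s)) (m<m+n (suc s) z<s))))
... | y , r , eq , bound′ = y , r , eq , subst (_≤ y) (sym (+-suc (suc s) i)) bound′
durfeeAux-drop s _       {[]}     _   ()

durfee-drop : ∀ {l i} → Linked _≥_ l → i < durfee l → ∃[ y ] ∃[ r ] drop i l ≡ y ∷ r × i < y
durfee-drop {i = i} = durfeeAux-drop 0 i

drop-suc : ∀ k (l : List ℕ) → drop (suc k) l ≡ drop 1 (drop k l)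
drop-suc zero    l       = refl
drop-suc (suc k) []      = refl
drop-suc (suc k) (_ ∷ l) = drop-suc k l

drop-Linked : ∀ {R : ℕ → ℕ → Set} k {l} → Linked R l → Linked R (drop k l)
drop-Linked zero            dec = dec
drop-Linked (suc k) {[]}    dec = dec
drop-Linked (suc k) {_ ∷ _} dec = drop-Linked k (Linked.tail dec)

sub-dropColumns : ∀ i j μ {x xs} → drop i μ ≡ x ∷ xs → j < x → sub i j μ ≡ dropColumns j (x ∷ xs)
sub-dropColumns i j μ {x} eq j<x with drop i μ | eq
... | _ | refl with j <ᵇ x | <⇒<ᵇ j<x
...   | true | _ = refl

sub-zero-zero : ∀ {μ} → IsPartition μ → sub 0 0 μ ≡ μ
sub-zero-zero {[]}        _ = refl
sub-zero-zero {suc _ ∷ _} p = dropColumns-zero (IsPartition.positive p)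
sub-zero-zero {zero ∷ _}  record { positive = () ∷ _ }

SG-sub-diagonal-suc : ∀ {μ k} → IsPartition μ → suc k < durfee μ →
                      SG (sub (suc k) (suc k) μ) ≡ SG (sub k k μ)
SG-sub-diagonal-suc {μ} {k} p k+1<d
  with durfee-drop (IsPartition.decreasing p) (<-trans (n<1+n k) k+1<d)
     | durfee-drop (IsPartition.decreasing p) k+1<d
... | x , xs , eₖ , k<x | y , r , eₖ₊₁ , k+1<y
  with trans (sym (trans (drop-suc k μ) (cong (drop 1) eₖ))) eₖ₊₁
... | refl = begin
  SG (sub (suc k) (suc k) μ)                      ≡⟨ cong SG (sub-dropColumns (suc k) (suc k) μ eₖ₊₁ k+1<y) ⟩
  SG (dropColumns (suc k) (y ∷ r))                ≡⟨ cong (λ n → SG (dropColumns n (y ∷ r))) (+-comm 1 k) ⟩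
  SG (dropColumns (k + 1) (y ∷ r))                ≡⟨ cong SG (sym (dropColumns-dropColumns 1 k (y ∷ r))) ⟩
  SG (dropColumns 1 (dropColumns k (y ∷ r)))      ≡⟨ cong (SG ∘ dropColumns 1) (dropColumns-cons k r k<y) ⟩
  SG (dropColumns 1 ((y ∸ k) ∷ dropColumns k r))  ≡⟨ SG-dropColumns-tail partition (dropColumns-≢[] _ 1<y∸k) ⟩
  SG ((x ∸ k) ∷ (y ∸ k) ∷ dropColumns k r)        ≡⟨ cong SG (sym (trans (sub-dropColumns k k μ eₖ k<x) cols)) ⟩
  SG (sub k k μ)                                  ∎
  where
  open ≡-Reasoning
  k<y : k < y
  k<y = <-trans (n<1+n k) k+1<y
  1<y∸k : 1 < y ∸ k
  1<y∸k = subst (_≤ y ∸ k) (m+n∸n≡m 2 k) (∸-monoˡ-≤ k k+1<y)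
  cols : dropColumns k (x ∷ y ∷ r) ≡ (x ∸ k) ∷ (y ∸ k) ∷ dropColumns k r
  cols = trans (dropColumns-cons k _ k<x) (cong ((x ∸ k) ∷_) (dropColumns-cons k r k<y))
  partition : IsPartition ((x ∸ k) ∷ (y ∸ k) ∷ dropColumns k r)
  partition = subst IsPartition cols
    (dropColumns-isPartition {k} (subst (Linked _≥_) eₖ (drop-Linked k (IsPartition.decreasing p))))

-- The hypothesis λ′ ≢ [] is implied by k < durfee λ′.
theorem4p5 : (λ′ : List ℕ) → IsPartition λ′ → λ′ ≢ [] →
    (k : ℕ) → k < durfee λ′ → SG (sub k k λ′) ≡ SG λ′
theorem4p5 λ′ p _  zero    _      = cong SG (sub-zero-zero p)
theorem4p5 λ′ p ne (suc k) k+1<d  =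
  trans (SG-sub-diagonal-suc p k+1<d) (theorem4p5 λ′ p ne k (<-trans (n<1+n k) k+1<d))
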